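{- For positive integers $n_1,\dots,n_t$, \[\operatorname{BR}^1(B_{n_1},C_{n_2},\dots,C_{n_t})=n_1+\sum_{i=2}^t(n_i-1).\]
   Context: $B_n$ denotes the Boolean lattice of all subsets of $[n]$ ordered by inclusion, and $C_n$ denotes a chain (totally ordered set) of $n$ elements. A copy of a poset $P$ in a poset $Q$ is the image of an injection $f:P\to Q$ with $f(x)\le f(y)$ whenever $x\le y$. $\operatorname{BR}^1(P_1,\dots,P_t)$ is the least $N$ such that every coloring of the elements of $B_N$ with colors $\{1,\dots,t\}$ contains, for some $i$, a copy of $P_i$ all of whose elements have color $i$. -}

module Defs where

open import Level using (0ℓ)
open import Data.Nat using (ℕ; _<_; _∸_)
open import Data.Fin using (Fin; zero; suc)
import Data.Fin as F
open import Data.Fin.Subset using (Subset; _⊆_)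
open import Data.Vec using (Vec; lookup; map; sum)
open import Data.Product using (Σ; ∃; _×_)
open import Relation.Binary.PropositionalEquality using (_≡_)
open import Relation.Nullary using (¬_)
open import Function.Definitions using (Injective)

record Poset : Set₁ where
  field
    Carrier : Set
    _≼_     : Carrier → Carrier → Set

open Poset public

B : ℕ → Poset
B n = record { Carrier = Subset n ; _≼_ = _⊆_ }

C : ℕ → Poset
C n = record { Carrier = Fin n ; _≼_ = F._≤_ }

MonoCopy : (N : ℕ) {t : ℕ} (c : Subset N → Fin t) (i : Fin t) (P : Poset) → Set
MonoCopy N c i P =
  Σ (Carrier P → Subset N) λ f →
    Injective _≡_ _≡_ f
    × (∀ x y → _≼_ P x y → f x ⊆ f y)
    × (∀ x → c (f x) ≡ i)

Arrows : (N : ℕ) {t : ℕ} (Ps : Fin t → Poset) → Set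
Arrows N {t} Ps = (c : Subset N → Fin t) → ∃ λ i → MonoCopy N c i (Ps i)

IsBR1 : {t : ℕ} (Ps : Fin t → Poset) (N : ℕ) → Set
IsBR1 Ps N = Arrows N Ps × (∀ M → M < N → ¬ Arrows M Ps)

-- The list (B_{n₁}, C_{n₂}, …, C_{n_t}), with ns = (n₂,…,n_t) of length s = t-1.
BChains : (n₁ : ℕ) {s : ℕ} (ns : Vec ℕ s) → Fin (Data.Nat.suc s) → Poset
BChains n₁ ns zero    = B n₁
BChains n₁ ns (suc i) = C (lookup ns i)

-- Upper bound, by induction on the number of chains.  Inside B_{N+k} sits the product
-- C_{k+1} × B_N, via (i, X) ↦ X ++ {1,…,i}.  Fix the colour a of one chain of length k + 1.
-- Either some X₀ ⊆ ⋯ ⊆ X_k has every (i, X_i) coloured a, which is an a-coloured copy of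
-- C_{k+1}, or there is a monotone section X ↦ (σ X, X) avoiding a: let σ X be the least
-- level i such that some a-coloured chain above X occupies every level above i.  Were
-- (σ X, X) coloured a, prepending it to that chain would contradict the minimality of σ X
-- (or, when σ X = 0, give a full chain).  The section is a copy of B_N using one colour
-- fewer, to which induction applies.
--
-- Lower bound: colour a set by its size, giving the first n₂ - 1 sizes colour 2, the next
-- n₃ - 1 colour 3, and so on, and all larger sizes colour 1.  A copy of C_{nᵢ} needs nᵢ
-- distinct sizes, and a copy of B_{n₁} contains a chain whose sizes span n₁ + 1 values
-- from Σ (nᵢ - 1) on.
module Submission where

open import Defs
open import Data.Nat using (ℕ; zero; suc; _+_; _∸_; _≤_; _<_; z≤n; s≤s)
open import Data.Nat.Properties
  using (≤-reflexive; +-identityʳ; +-suc; +-monoˡ-≤; +-assoc; +-comm; <-irrefl; module ≤-Reasoning)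
open import Data.Fin as F using (Fin; zero; suc; fromℕ; punchIn; punchOut)
open import Data.Fin.Properties using (punchIn-punchOut; 0≢1+n) renaming (suc-injective to Fin-suc-injective)
open import Data.Fin.Subset using (Subset; _⊆_; _⊂_; ∣_∣; inside; outside) renaming (⊥ to ∅)
open import Data.Fin.Subset.Properties
  using (_⊆?_; anySubset?; ⊆-refl; ⊆-trans; ⊆-min; s⊆s; drop-∷-⊆; out⊂; out⊂in; s⊂s; p⊂q⇒∣p∣<∣q∣; ∣p∣≤n)
open import Data.Vec using (Vec; []; _∷_; _++_; lookup; map; sum)
open import Data.Vec.Base using (here; there)
open import Data.Vec.Properties using (++-injectiveˡ; ++-injectiveʳ; ∷-injectiveʳ)
open import Data.Vec.Relation.Unary.All using (All; []; _∷_)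
open import Data.Product using (Σ; ∃; _×_; _,_; proj₁; proj₂)
open import Data.Sum using (_⊎_; inj₁; inj₂)
open import Function using (_∘_; id)
open import Function.Definitions using (Injective)
open import Relation.Binary.PropositionalEquality using (_≡_; _≢_; refl; sym; trans; cong; subst)
open import Relation.Nullary using (¬_; Dec; yes; no; contradiction)
open import Relation.Nullary.Decidable using (_×-dec_)

IsEmbedding : (P Q : Poset) → (Carrier P → Carrier Q) → Set
IsEmbedding P Q f = Injective _≡_ _≡_ f × (∀ x y → _≼_ P x y → _≼_ Q (f x) (f y))

Embedding : Poset → Poset → Set
Embedding P Q = Σ (Carrier P → Carrier Q) (IsEmbedding P Q)

MonoCopy-restrict : ∀ {N t} {c : Subset N → Fin t} {i P Q} →
  MonoCopy N c i Q → Embedding P Q → MonoCopy N c i P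
MonoCopy-restrict (f , f-inj , f-mono , f-col) (g , g-inj , g-mono) =
  f ∘ g , g-inj ∘ f-inj , (λ x y x≼y → f-mono _ _ (g-mono x y x≼y)) , f-col ∘ g

MonoCopy-transport : ∀ {N N′ t t′} {c : Subset N′ → Fin t} {c′ : Subset N → Fin t′} {i P} →
  ((e , _) : Embedding (B N) (B N′)) (φ : Fin t′ → Fin t) → (∀ X → c (e X) ≡ φ (c′ X)) →
  MonoCopy N c′ i P → MonoCopy N′ c (φ i) P
MonoCopy-transport (e , e-inj , e-mono) φ recolour (f , f-inj , f-mono , f-col) =
  e ∘ f , f-inj ∘ e-inj , (λ x y x≼y → e-mono _ _ (f-mono x y x≼y)) ,
  λ x → trans (recolour (f x)) (cong φ (f-col x))

++-mono-⊆ : ∀ {m n} {p q : Subset m} {r s : Subset n} → p ⊆ q → r ⊆ s → p ++ r ⊆ q ++ s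
++-mono-⊆ {p = []} {[]} _ r⊆s x∈r = r⊆s x∈r
++-mono-⊆ {p = _ ∷ _} {_ ∷ _} p⊆q r⊆s here with p⊆q here
... | here = here
++-mono-⊆ {p = _ ∷ _} {_ ∷ _} p⊆q r⊆s (there x∈p++r) = there (++-mono-⊆ (drop-∷-⊆ p⊆q) r⊆s x∈p++r)

p⊆q∧p≢q⇒∣p∣<∣q∣ : ∀ {n} {p q : Subset n} → p ⊆ q → p ≢ q → ∣ p ∣ < ∣ q ∣
p⊆q∧p≢q⇒∣p∣<∣q∣ p⊆q p≢q = p⊂q⇒∣p∣<∣q∣ (⊆∧≢⇒⊂ p⊆q p≢q)
  where
  ⊆∧≢⇒⊂ : ∀ {n} {p q : Subset n} → p ⊆ q → p ≢ q → p ⊂ q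
  ⊆∧≢⇒⊂ {p = []} {[]} _ p≢q = contradiction refl p≢q
  ⊆∧≢⇒⊂ {p = outside ∷ p} {outside ∷ q} p⊆q p≢q = out⊂ (⊆∧≢⇒⊂ (drop-∷-⊆ p⊆q) (p≢q ∘ cong (outside ∷_)))
  ⊆∧≢⇒⊂ {p = outside ∷ p} {inside ∷ q} p⊆q _ = out⊂in (drop-∷-⊆ p⊆q)
  ⊆∧≢⇒⊂ {p = inside ∷ p} {outside ∷ q} p⊆q _ with p⊆q here
  ... | ()
  ⊆∧≢⇒⊂ {p = inside ∷ p} {inside ∷ q} p⊆q p≢q = s⊂s (⊆∧≢⇒⊂ (drop-∷-⊆ p⊆q) (p≢q ∘ cong (inside ∷_)))

prefix : ∀ {m} → Fin (suc m) → Subset m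
prefix zero = ∅
prefix {suc m} (suc i) = inside ∷ prefix i

prefix-mono : ∀ {m} {i j : Fin (suc m)} → i F.≤ j → prefix i ⊆ prefix j
prefix-mono {i = zero} {j} _ = ⊆-min (prefix j)
prefix-mono {suc m} {suc i} {suc j} (s≤s i≤j) = s⊆s (prefix-mono i≤j)

prefix-injective : ∀ {m} → Injective _≡_ _≡_ (prefix {m})
prefix-injective {x = zero} {zero} _ = refl
prefix-injective {suc m} {zero} {suc j} ()
prefix-injective {suc m} {suc i} {zero} ()
prefix-injective {suc m} {suc i} {suc j} eq = cong suc (prefix-injective (∷-injectiveʳ eq))

prefixChain : ∀ m → Embedding (C (suc m)) (B m)
prefixChain m = prefix , prefix-injective , λ _ _ → prefix-mono

layer : ∀ {N m} → Fin (suc m) → Subset N → Subset (N + m)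
layer i X = X ++ prefix i

layer-mono : ∀ {N m} {i j : Fin (suc m)} {X Y : Subset N} → i F.≤ j → X ⊆ Y → layer i X ⊆ layer j Y
layer-mono i≤j X⊆Y = ++-mono-⊆ X⊆Y (prefix-mono i≤j)

layer-injectiveˡ : ∀ {N m} (i j : Fin (suc m)) (X Y : Subset N) → layer i X ≡ layer j Y → i ≡ j
layer-injectiveˡ i j X Y eq = prefix-injective (++-injectiveʳ X Y eq)

layer-injectiveʳ : ∀ {N m} (i j : Fin (suc m)) (X Y : Subset N) → layer i X ≡ layer j Y → X ≡ Y
layer-injectiveʳ i j X Y eq = ++-injectiveˡ X Y eq

module _ {N t : ℕ} (a : Fin t) where

  -- γ colours the product C_{k+1} × B_N; ChainAbove γ X says that some X ⊆ Y₀ ⊆ ⋯ ⊆ Y_k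
  -- has every (i , Y_i) coloured a.
  ChainAbove : ∀ {k} → (Fin (suc k) → Subset N → Fin t) → Subset N → Set
  ChainAbove {zero}  γ X = ∃ λ Y → X ⊆ Y × γ zero Y ≡ a
  ChainAbove {suc k} γ X = ∃ λ Y → X ⊆ Y × γ zero Y ≡ a × ChainAbove (γ ∘ suc) Y

  chainAbove? : ∀ {k} (γ : Fin (suc k) → Subset N → Fin t) X → Dec (ChainAbove γ X)
  chainAbove? {zero}  γ X = anySubset? λ Y → X ⊆? Y ×-dec γ zero Y F.≟ a
  chainAbove? {suc k} γ X = anySubset? λ Y → X ⊆? Y ×-dec γ zero Y F.≟ a ×-dec chainAbove? (γ ∘ suc) Y

  chainAbove-antitone : ∀ {k} {γ : Fin (suc k) → Subset N → Fin t} {X X′} →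
    X ⊆ X′ → ChainAbove γ X′ → ChainAbove γ X
  chainAbove-antitone {zero}  X⊆X′ (Y , X′⊆Y , rest) = Y , ⊆-trans X⊆X′ X′⊆Y , rest
  chainAbove-antitone {suc k} X⊆X′ (Y , X′⊆Y , rest) = Y , ⊆-trans X⊆X′ X′⊆Y , rest

  chainOf : ∀ {k} {γ : Fin (suc k) → Subset N → Fin t} {X} → ChainAbove γ X → Fin (suc k) → Subset N
  chainOf {zero}  (Y , _) zero = Y
  chainOf {suc k} (Y , _) zero = Y
  chainOf {suc k} (_ , _ , _ , rest) (suc i) = chainOf rest i

  chainOf-above : ∀ {k} {γ : Fin (suc k) → Subset N → Fin t} {X} (r : ChainAbove γ X) i → X ⊆ chainOf r i
  chainOf-above {zero}  (_ , X⊆Y , _) zero = X⊆Y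
  chainOf-above {suc k} (_ , X⊆Y , _) zero = X⊆Y
  chainOf-above {suc k} (_ , X⊆Y , _ , rest) (suc i) = ⊆-trans X⊆Y (chainOf-above rest i)

  chainOf-mono : ∀ {k} {γ : Fin (suc k) → Subset N → Fin t} {X} (r : ChainAbove γ X) {i j} →
    i F.≤ j → chainOf r i ⊆ chainOf r j
  chainOf-mono {zero}  _ {zero} {zero} _ = ⊆-refl
  chainOf-mono {suc k} _ {zero} {zero} _ = ⊆-refl
  chainOf-mono {suc k} (_ , _ , _ , rest) {zero} {suc j} _ = chainOf-above rest j
  chainOf-mono {suc k} (_ , _ , _ , rest) {suc i} {suc j} (s≤s i≤j) = chainOf-mono rest i≤j

  chainOf-colour : ∀ {k} {γ : Fin (suc k) → Subset N → Fin t} {X} (r : ChainAbove γ X) i →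
    γ i (chainOf r i) ≡ a
  chainOf-colour {zero}  (_ , _ , colour) zero = colour
  chainOf-colour {suc k} (_ , _ , colour , _) zero = colour
  chainOf-colour {suc k} (_ , _ , _ , rest) (suc i) = chainOf-colour rest i

  select : ∀ {k} → (Fin (suc k) → Subset N → Fin t) → Subset N → Fin (suc k)
  select {zero}  γ X = zero
  select {suc k} γ X with chainAbove? (γ ∘ suc) X
  ... | yes _ = zero
  ... | no  _ = suc (select (γ ∘ suc) X)

  select-mono : ∀ {k} (γ : Fin (suc k) → Subset N → Fin t) {X Y} → X ⊆ Y → select γ X F.≤ select γ Y
  select-mono {zero}  γ _ = z≤n
  select-mono {suc k} γ {X} {Y} X⊆Y with chainAbove? (γ ∘ suc) X | chainAbove? (γ ∘ suc) Y
  ... | yes _  | _      = z≤n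
  ... | no ¬rX | yes rY = contradiction (chainAbove-antitone X⊆Y rY) ¬rX
  ... | no _   | no _   = s≤s (select-mono (γ ∘ suc) X⊆Y)

  select-avoids : ∀ {k} (γ : Fin (suc k) → Subset N → Fin t) {X} → ¬ ChainAbove γ X → γ (select γ X) X ≢ a
  select-avoids {zero}  γ {X} ¬r colour = ¬r (X , ⊆-refl , colour)
  select-avoids {suc k} γ {X} ¬r with chainAbove? (γ ∘ suc) X
  ... | yes r  = λ colour → ¬r (X , ⊆-refl , colour , r)
  ... | no ¬r′ = select-avoids (γ ∘ suc) ¬r′

  ColouredChain : ∀ {k} → (Fin (suc k) → Subset N → Fin t) → Set
  ColouredChain {k} γ = Σ (Fin (suc k) → Subset N) λ σ →
    (∀ {i j} → i F.≤ j → σ i ⊆ σ j) × (∀ i → γ i (σ i) ≡ a)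

  AvoidingSection : ∀ {k} → (Fin (suc k) → Subset N → Fin t) → Set
  AvoidingSection {k} γ = Σ (Subset N → Fin (suc k)) λ σ →
    (∀ {X Y} → X ⊆ Y → σ X F.≤ σ Y) × (∀ X → γ (σ X) X ≢ a)

  colouredChain⊎avoidingSection : ∀ {k} (γ : Fin (suc k) → Subset N → Fin t) →
    ColouredChain γ ⊎ AvoidingSection γ
  colouredChain⊎avoidingSection γ with chainAbove? γ ∅
  ... | yes r = inj₁ (chainOf r , chainOf-mono r , chainOf-colour r)
  ... | no ¬r = inj₂ (select γ , select-mono γ , λ X → select-avoids γ (¬r ∘ chainAbove-antitone (⊆-min X)))

layerSection : ∀ {N m} (σ : Subset N → Fin (suc m)) → (∀ {X Y} → X ⊆ Y → σ X F.≤ σ Y) →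
  Embedding (B N) (B (N + m))
layerSection σ σ-mono = (λ X → layer (σ X) X) , (λ {X} {Y} → layer-injectiveʳ (σ X) (σ Y) X Y) , λ _ _ X⊆Y → layer-mono (σ-mono X⊆Y) X⊆Y

arrows-avoiding : ∀ {N N′ t} {Ps : Fin t → Poset} (c : Subset N′ → Fin (suc t)) a →
  ((e , _) : Embedding (B N) (B N′)) → (∀ X → c (e X) ≢ a) →
  Arrows N Ps → ∃ λ i → MonoCopy N′ c (punchIn a i) (Ps i)
arrows-avoiding c a e avoids arrows with arrows (λ X → punchOut (avoids X ∘ sym))
... | i , copy = i , MonoCopy-transport {c = c} e (punchIn a) (λ X → sym (punchIn-punchOut (avoids X ∘ sym))) copy

arrows-B : ∀ n → Arrows n (BChains n [])
arrows-B n c = zero , id , id , (λ _ _ X⊆Y → X⊆Y) , λ X → Fin1-zero (c X)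
  where
  Fin1-zero : (i : Fin 1) → i ≡ zero
  Fin1-zero zero = refl

arrows-consChain : ∀ {N n₁ s} w (ns : Vec ℕ s) →
  Arrows N (BChains n₁ ns) → Arrows (N + w) (BChains n₁ (suc w ∷ ns))
arrows-consChain w ns arrows c with colouredChain⊎avoidingSection (suc zero) (λ i X → c (layer i X))
... | inj₁ (σ , σ-mono , σ-colour) =
  suc zero , (λ i → layer i (σ i)) , (λ {i} {j} → layer-injectiveˡ i j (σ i) (σ j)) , (λ _ _ i≤j → layer-mono i≤j (σ-mono i≤j)) , σ-colour
... | inj₂ (σ , σ-mono , σ-avoids) with arrows-avoiding c (suc zero) (layerSection σ σ-mono) σ-avoids arrows
...   | zero  , copy = zero , copy
...   | suc i , copy = suc (suc i) , copy

arrows-upper : ∀ n₁ {s} (ns : Vec ℕ s) → All (1 ≤_) ns → Arrows (n₁ + sum (map (_∸ 1) ns)) (BChains n₁ ns)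
arrows-upper n₁ [] [] = subst (λ N → Arrows N (BChains n₁ [])) (sym (+-identityʳ n₁)) (arrows-B n₁)
arrows-upper n₁ (suc w ∷ ns) (_ ∷ ps) =
  subst (λ N → Arrows N (BChains n₁ (suc w ∷ ns))) (trans (+-assoc n₁ r w) (cong (n₁ +_) (+-comm r w)))
    (arrows-consChain w ns (arrows-upper n₁ ns ps))
  where r = sum (map (_∸ 1) ns)

chain-card-spread : ∀ {M k} {f : Fin (suc k) → Subset M} → IsEmbedding (C (suc k)) (B M) f →
  ∣ f zero ∣ + k ≤ ∣ f (fromℕ k) ∣
chain-card-spread {k = zero} _ = ≤-reflexive (+-identityʳ _)
chain-card-spread {k = suc k} {f} (f-inj , f-mono) = begin
  ∣ f zero ∣ + suc k       ≡⟨ +-suc ∣ f zero ∣ k ⟩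
  suc ∣ f zero ∣ + k       ≤⟨ +-monoˡ-≤ k (p⊆q∧p≢q⇒∣p∣<∣q∣ (f-mono zero (suc zero) z≤n) (0≢1+n ∘ f-inj)) ⟩
  ∣ f (suc zero) ∣ + k     ≤⟨ chain-card-spread {f = f ∘ suc} (Fin-suc-injective ∘ f-inj , λ x y x≤y → f-mono (suc x) (suc y) (s≤s x≤y)) ⟩
  ∣ f (fromℕ (suc k)) ∣    ∎
  where open ≤-Reasoning

-- Block colouring: sizes below w₁ get colour 1, the next w₂ sizes colour 2, and so on;
-- sizes from w₁ + ⋯ + w_s on get colour 0.
rankColour : ∀ {s} → Vec ℕ s → ℕ → Fin (suc s)
rankColour []           r       = zero
rankColour (zero  ∷ ws) r       = punchIn (suc zero) (rankColour ws r)
rankColour (suc w ∷ ws) zero    = suc zero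
rankColour (suc w ∷ ws) (suc r) = rankColour (w ∷ ws) r

offset : ∀ {s} → Vec ℕ s → Fin s → ℕ
offset (w ∷ ws) zero    = 0
offset (w ∷ ws) (suc i) = w + offset ws i

rankColour-zero : ∀ {s} (ws : Vec ℕ s) r → rankColour ws r ≡ zero → sum ws ≤ r
rankColour-zero [] r _ = z≤n
rankColour-zero (zero ∷ ws) r eq with rankColour ws r in eq′
rankColour-zero (zero ∷ ws) r _  | zero = rankColour-zero ws r eq′
rankColour-zero (zero ∷ ws) r () | suc _
rankColour-zero (suc w ∷ ws) (suc r) eq = s≤s (rankColour-zero (w ∷ ws) r eq)

rankColour-suc : ∀ {s} (ws : Vec ℕ s) r i → rankColour ws r ≡ suc i →
  offset ws i ≤ r × r < offset ws i + lookup ws i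
rankColour-suc (zero ∷ ws) r i eq with rankColour ws r in eq′
rankColour-suc (zero ∷ ws) r i () | zero
rankColour-suc (zero ∷ ws) r .(suc j) refl | suc j = rankColour-suc ws r j eq′
rankColour-suc (suc w ∷ ws) zero zero refl = z≤n , s≤s z≤n
rankColour-suc (suc w ∷ ws) (suc r) zero eq = z≤n , s≤s (proj₂ (rankColour-suc (w ∷ ws) r zero eq))
rankColour-suc (suc w ∷ ws) (suc r) (suc i) eq with rankColour-suc (w ∷ ws) r (suc i) eq
... | offset≤r , r<end = s≤s offset≤r , s≤s r<end

rankColouring : ∀ {M s} → Vec ℕ s → Subset M → Fin (suc s)
rankColouring ws X = rankColour ws ∣ X ∣

rankColouring-noChain : ∀ {M s} (ws : Vec ℕ s) j →
  ¬ MonoCopy M (rankColouring ws) (suc j) (C (suc (lookup ws j)))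
rankColouring-noChain ws j (f , f-inj , f-mono , f-col) = <-irrefl refl (begin-strict
  offset ws j + lookup ws j  ≤⟨ +-monoˡ-≤ (lookup ws j) (proj₁ (rankColour-suc ws _ j (f-col zero))) ⟩
  ∣ f zero ∣ + lookup ws j   ≤⟨ chain-card-spread (f-inj , f-mono) ⟩
  ∣ f (fromℕ _) ∣            <⟨ proj₂ (rankColour-suc ws _ j (f-col (fromℕ _))) ⟩
  offset ws j + lookup ws j  ∎)
  where open ≤-Reasoning

rankColouring-noB : ∀ {M s} n (ws : Vec ℕ s) → M < n + sum ws → ¬ MonoCopy M (rankColouring ws) zero (B n)
rankColouring-noB {M} n ws M<n+sum copy with MonoCopy-restrict {c = rankColouring ws} copy (prefixChain n)
... | f , f-inj , f-mono , f-col = <-irrefl refl (begin-strict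
  M                  <⟨ M<n+sum ⟩
  n + sum ws         ≡⟨ +-comm n (sum ws) ⟩
  sum ws + n         ≤⟨ +-monoˡ-≤ n (rankColour-zero ws _ (f-col zero)) ⟩
  ∣ f zero ∣ + n     ≤⟨ chain-card-spread (f-inj , f-mono) ⟩
  ∣ f (fromℕ n) ∣    ≤⟨ ∣p∣≤n (f (fromℕ n)) ⟩
  M                  ∎)
  where open ≤-Reasoning

lookup-suc-pred : ∀ {s} {ns : Vec ℕ s} → All (1 ≤_) ns → ∀ j → lookup ns j ≡ suc (lookup (map (_∸ 1) ns) j)
lookup-suc-pred (s≤s z≤n ∷ _) zero = refl
lookup-suc-pred (_ ∷ ps) (suc j) = lookup-suc-pred ps j

not-arrows-below : ∀ n₁ {s} (ns : Vec ℕ s) → All (1 ≤_) ns →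
  ∀ M → M < n₁ + sum (map (_∸ 1) ns) → ¬ Arrows M (BChains n₁ ns)
not-arrows-below n₁ ns ps M M<bound arrows with arrows (rankColouring (map (_∸ 1) ns))
... | zero  , copy = rankColouring-noB n₁ (map (_∸ 1) ns) M<bound copy
... | suc j , copy = rankColouring-noChain (map (_∸ 1) ns) j
  (subst (λ L → MonoCopy M (rankColouring (map (_∸ 1) ns)) (suc j) (C L)) (lookup-suc-pred ps j) copy)

theorem2p2 : (n₁ : ℕ) {s : ℕ} (ns : Vec ℕ s) → 1 ≤ n₁ → All (1 ≤_) ns →
    IsBR1 (BChains n₁ ns) (n₁ + sum (map (_∸ 1) ns))
theorem2p2 n₁ ns _ ps = arrows-upper n₁ ns ps , not-arrows-below n₁ ns ps
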